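{- Let $G$ be an $r$-uniform hypergraph, let $\mathcal{V}=(V_0,\dots,V_{r-1})$ be a tuple of pairwise disjoint vertex sets and $\mathcal{U}=(U_1,\dots,U_{r-1})$ a tuple of (not necessarily disjoint) vertex sets with $|U_i|=m$ for all $i\in[r-1]$, such that $\bigcup_{i\in[r-1]}U_i$ is disjoint from $\bigcup_{0\leq i\leq r-1}V_i$. Let $m^*\leq m$ be a positive integer and suppose that (A1) $|V_0|\leq\min_{i\in[r-1]}|V_i|$ and (A2) $\alpha^*_{\mathcal{V}}(G)\leq m^*$. Then $G$ contains a matching $M'$ in $G[\mathcal{V}]$ covering at least $|V_0|-m^*$ vertices of $V_0$. Furthermore, if in addition (A3) $d_G(v,\mathcal{U})\geq(r-1)^2m^{r-2}m^*$ for all $v\in V_0$, then there exists an additional matching $M''$ with $|M''|\leq m^*$, each of whose edges crosses $(V_0,U_1,\dots,U_{r-1})$, such that $M=M'\cup M''$ is a matching covering all vertices of $V_0$.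
   Context: A set $\{x_1,\dots,x_r\}$ of $r$ distinct vertices crosses a tuple $(X_1,\dots,X_r)$ if $x_i\in X_i$ for all $i$. $G[\mathcal{V}]$ is the subgraph of edges crossing $\mathcal{V}$. For $X_1,\dots,X_r$, $e_G(X_1,\dots,X_r)$ is the number of tuples $(x_1,\dots,x_r)\in X_1\times\dots\times X_r$ with $\{x_1,\dots,x_r\}\in E(G)$, and $d_G(v,\mathcal{U})=e_G(\{v\},U_1,\dots,U_{r-1})$. $\alpha^*_{\mathcal{V}}(G)$ is the largest $t$ such that there exist $X_i\subseteq V_i$ with $|X_i|=t$ for all $i$ and $e_G(X_0,\dots,X_{r-1})=0$. A matching is a set of pairwise disjoint edges. -}

module Defs where

open import Data.Nat using (ℕ; zero; suc; _≤_)
open import Data.Bool using (Bool; true; false; _∧_; T)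
open import Data.Fin using (Fin)
open import Data.Fin.Subset using (Subset; ⁅_⁆; _∪_; _∩_; ⊥; ∣_∣; _∈_; _⊆_; Empty; ⋃)
open import Data.Vec using (Vec; []; _∷_; lookup)
open import Data.List using (List; []; _∷_; map; concatMap; length; filterᵇ; allFin)
open import Data.List.Relation.Unary.All using (All)
open import Data.List.Relation.Unary.AllPairs using (AllPairs)
open import Data.Product using (Σ; _×_)
open import Relation.Binary.PropositionalEquality using (_≡_)

record Hypergraph (n r : ℕ) : Set where
  field
    edge    : Subset n → Bool
    uniform : ∀ (e : Subset n) → T (edge e) → ∣ e ∣ ≡ r
open Hypergraph public

IsEdge : ∀ {n r} → Hypergraph n r → Subset n → Set
IsEdge G e = T (edge G e)

toSet : ∀ {n k} → Vec (Fin n) k → Subset n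
toSet []       = ⊥
toSet (x ∷ xs) = ⁅ x ⁆ ∪ toSet xs

inTupleᵇ : ∀ {n k} → Vec (Subset n) k → Vec (Fin n) k → Bool
inTupleᵇ []       []       = true
inTupleᵇ (S ∷ Ss) (x ∷ xs) = lookup S x ∧ inTupleᵇ Ss xs

allTuples : ∀ {n} (k : ℕ) → List (Vec (Fin n) k)
allTuples zero    = [] ∷ []
allTuples {n} (suc k) = concatMap (λ x → map (x ∷_) (allTuples k)) (allFin n)

eG : ∀ {n r} → Hypergraph n r → Vec (Subset n) r → ℕ
eG {r = r} G X =
  length (filterᵇ (λ xs → inTupleᵇ X xs ∧ edge G (toSet xs)) (allTuples r))

dG : ∀ {n k} → Hypergraph n (suc k) → Fin n → Vec (Subset n) k → ℕ
dG G v U = eG G (⁅ v ⁆ ∷ U)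

Crosses : ∀ {n r} → Subset n → Vec (Subset n) r → Set
Crosses {n} {r} e X =
  Σ (Vec (Fin n) r) λ xs → (∀ i → lookup xs i ∈ lookup X i) × toSet xs ≡ e

Disjoint : ∀ {n} → Subset n → Subset n → Set
Disjoint p q = Empty (p ∩ q)

IsMatching : ∀ {n r} → Hypergraph n r → List (Subset n) → Set
IsMatching G M = All (IsEdge G) M × AllPairs Disjoint M

IsMatchingIn : ∀ {n r} → Hypergraph n r → Vec (Subset n) r → List (Subset n) → Set
IsMatchingIn G V M = IsMatching G M × All (λ e → Crosses e V) M

IndepTuple : ∀ {n r} → Hypergraph n r → Vec (Subset n) r → ℕ → Set
IndepTuple {n} {r} G V t =
  Σ (Vec (Subset n) r) λ X →
    (∀ i → lookup X i ⊆ lookup V i) × (∀ i → ∣ lookup X i ∣ ≡ t) × eG G X ≡ 0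

-- α*_V(G) ≤ m*  (α* is the largest attained t, so this says every attained t is ≤ m*)
AlphaStarAtMost : ∀ {n r} → Hypergraph n r → Vec (Subset n) r → ℕ → Set
AlphaStarAtMost G V m* = ∀ t → IndepTuple G V t → t ≤ m*

{-# OPTIONS --safe #-}

-- A greedy maximal matching M′ of G[V] meets every edge of G[V]. Each of its edges has exactly
-- one vertex in every Vᵢ, so each Vᵢ has exactly |M′| covered vertices, and since V₀ is the
-- smallest part, each Vᵢ keeps at least t = |V₀ ∖ ⋃ M′| uncovered vertices. Subsets of size t
-- of the uncovered parts span no edge, hence t ≤ α*_V(G) ≤ m*.
-- The t uncovered vertices w of V₀ are then matched one at a time by edges {w, x₁, …, x_k}
-- with xᵢ ∈ Uᵢ. When j < m* edges have been chosen, their vertices in the Uᵢ form a set B of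
-- size at most k·j, and at most k·m^(k-1)·|B| ≤ k²·m^(k-1)·j tuples of U₁ × ⋯ × U_k meet B;
-- as d(w, U) ≥ k²·m^(k-1)·m*, some edge through w avoids all earlier edges.

module Submission where

open import Defs
open import Data.Nat using (ℕ; suc; _≤_; _≥_; _*_; _^_; _∸_)
open import Data.Fin using (Fin)
open import Data.Fin.Subset using (Subset; _∈_; _∩_; _⊆_; ∣_∣; ⋃)
open import Data.Vec using (Vec; lookup; head; _∷_)
open import Data.List using (List; length; _++_)
open import Data.List.Relation.Unary.All using (All)
open import Data.Product using (Σ; _×_)
open import Relation.Binary.PropositionalEquality using (_≡_; _≢_)

open import Data.Bool using (Bool; true; false; T; T?; _∧_; _∨_; not)
open import Data.Bool.Properties using (T-≡; T-∧; T-∨)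
open import Data.Empty using (⊥-elim)
open import Data.Fin using (zero; suc; _≟_)
open import Data.Fin.Subset using (⊥; ⊤; ⁅_⁆; _∪_; ∁; _∉_; Nonempty; inside; outside)
open import Data.Fin.Subset.Properties
open import Data.List using ([]; _∷_; map; foldr; filterᵇ; allFin; tabulate; concatMap)
open import Data.List.Properties using (filter-++; length-++)
open import Data.List.Membership.Propositional using (lose) renaming (_∈_ to _∈ₗ_)
open import Data.List.Membership.Propositional.Properties using (∈-allFin; ∈-map⁺; ∈-filter⁺; ∈-concatMap⁺)
open import Data.List.Relation.Unary.All as All using ([]; _∷_)
open import Data.List.Relation.Unary.All.Properties using (all-filter; map⁺) renaming (++⁺ to All-++⁺)
open import Data.List.Relation.Unary.AllPairs using (AllPairs; []; _∷_)
import Data.List.Relation.Unary.Any as Any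
import Data.List.Relation.Unary.AllPairs.Properties as AllPairs
open import Data.Nat using (zero; _+_; _<_; z≤n; s≤s; NonZero; >-nonZero)
open import Data.Nat.Tactic.RingSolver using (solve-∀)
open import Data.Nat.Properties hiding (_≟_)
open import Data.Product using (∃-syntax; _,_; proj₁; proj₂)
open import Data.Sum using (_⊎_; inj₁; inj₂)
open import Data.Vec using ([]; here)
import Data.Vec as Vec
open import Data.Vec.Properties using ([]=⇒lookup; lookup⇒[]=; tabulate∘lookup; lookup∘tabulate)
open import Function using (_∘_; id; case_of_)
open import Function.Bundles using (Equivalence)
open import Relation.Binary.PropositionalEquality
  using (refl; sym; trans; cong; cong₂; subst; module ≡-Reasoning)
open import Relation.Nullary using (¬_; yes; no)

private
  variable
    n k : ℕ

∈⇒T : ∀ {x : Fin n} {p : Subset n} → x ∈ p → T (lookup p x)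
∈⇒T x∈p = Equivalence.from T-≡ ([]=⇒lookup x∈p)

T⇒∈ : ∀ {x : Fin n} {p : Subset n} → T (lookup p x) → x ∈ p
T⇒∈ {x = x} {p} h = lookup⇒[]= x p (Equivalence.to T-≡ h)

Disjoint⁺ : ∀ {p q : Subset n} → (∀ {x} → x ∈ p → x ∉ q) → Disjoint p q
Disjoint⁺ {p = p} {q} h (x , x∈p∩q) = let (x∈p , x∈q) = x∈p∩q⁻ p q x∈p∩q in h x∈p x∈q

Disjoint⁻ : ∀ {p q : Subset n} {x} → Disjoint p q → x ∈ p → x ∉ q
Disjoint⁻ d x∈p x∈q = d (_ , x∈p∩q⁺ (x∈p , x∈q))

Disjoint-sym : ∀ {p q : Subset n} → Disjoint p q → Disjoint q p
Disjoint-sym d = Disjoint⁺ λ x∈q x∈p → Disjoint⁻ d x∈p x∈q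

Disjoint-mono : ∀ {p p′ q q′ : Subset n} → p′ ⊆ p → q′ ⊆ q → Disjoint p q → Disjoint p′ q′
Disjoint-mono p′⊆p q′⊆q d = Disjoint⁺ λ x∈p′ x∈q′ → Disjoint⁻ d (p′⊆p x∈p′) (q′⊆q x∈q′)

Disjoint-∪ʳ : ∀ {p q r : Subset n} → Disjoint p q → Disjoint p r → Disjoint p (q ∪ r)
Disjoint-∪ʳ {q = q} {r} d e = Disjoint⁺ λ x∈p x∈q∪r → case x∈p∪q⁻ q r x∈q∪r of λ
  { (inj₁ x∈q) → Disjoint⁻ d x∈p x∈q
  ; (inj₂ x∈r) → Disjoint⁻ e x∈p x∈r
  }

Disjoint-∪ˡ : ∀ {p q r : Subset n} → Disjoint p r → Disjoint q r → Disjoint (p ∪ q) r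
Disjoint-∪ˡ d e = Disjoint-sym (Disjoint-∪ʳ (Disjoint-sym d) (Disjoint-sym e))

Disjoint-⁅x⁆ : ∀ {x} {p : Subset n} → x ∉ p → Disjoint ⁅ x ⁆ p
Disjoint-⁅x⁆ {p = p} x∉p = Disjoint⁺ λ y∈⁅x⁆ → subst (_∉ p) (sym (x∈⁅y⁆⇒x≡y _ y∈⁅x⁆)) x∉p

Disjoint-∩∁ : ∀ {p q r : Subset n} → Disjoint p (r ∩ ∁ q) → Disjoint p q → Disjoint p r
Disjoint-∩∁ {r = r} d e = Disjoint⁺ λ x∈p x∈r → Disjoint⁻ d x∈p (x∈p∩q⁺ (x∈r , x∉p⇒x∈∁p (Disjoint⁻ e x∈p)))

Disjoint-⋃⁺ : ∀ {p : Subset n} {es} → All (Disjoint p) es → Disjoint p (⋃ es)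
Disjoint-⋃⁺ []       = Disjoint⁺ λ _ x∈⊥ → ∉⊥ x∈⊥
Disjoint-⋃⁺ (d ∷ ds) = Disjoint-∪ʳ d (Disjoint-⋃⁺ ds)

Disjoint-⋃⁻ : ∀ {p : Subset n} es → Disjoint p (⋃ es) → All (Disjoint p) es
Disjoint-⋃⁻ []       _ = []
Disjoint-⋃⁻ (e ∷ es) d =
  Disjoint-mono ⊆-refl (p⊆p∪q (⋃ es)) d ∷ Disjoint-⋃⁻ es (Disjoint-mono ⊆-refl (q⊆p∪q e (⋃ es)) d)

⋃-++ : ∀ (es fs : List (Subset n)) → ⋃ (es ++ fs) ≡ ⋃ es ∪ ⋃ fs
⋃-++ []       fs = sym (∪-identityˡ (⋃ fs))
⋃-++ (e ∷ es) fs = trans (cong (e ∪_) (⋃-++ es fs)) (sym (∪-assoc e (⋃ es) (⋃ fs)))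

Nonempty-∩-monoʳ : ∀ {p q r : Subset n} → q ⊆ r → Nonempty (p ∩ q) → Nonempty (p ∩ r)
Nonempty-∩-monoʳ {p = p} {q} q⊆r (x , x∈p∩q) =
  let (x∈p , x∈q) = x∈p∩q⁻ p q x∈p∩q in x , x∈p∩q⁺ (x∈p , q⊆r x∈q)

∣p∪q∣≤∣p∣+∣q∣ : ∀ (p q : Subset n) → ∣ p ∪ q ∣ ≤ ∣ p ∣ + ∣ q ∣
∣p∪q∣≤∣p∣+∣q∣ []            []            = z≤n
∣p∪q∣≤∣p∣+∣q∣ (inside ∷ p)  (s ∷ q)       =
  s≤s (≤-trans (∣p∪q∣≤∣p∣+∣q∣ p q) (+-monoʳ-≤ ∣ p ∣ (∣p∣≤∣x∷p∣ s q)))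
∣p∪q∣≤∣p∣+∣q∣ (outside ∷ p) (inside ∷ q)  =
  ≤-trans (s≤s (∣p∪q∣≤∣p∣+∣q∣ p q)) (≤-reflexive (sym (+-suc ∣ p ∣ ∣ q ∣)))
∣p∪q∣≤∣p∣+∣q∣ (outside ∷ p) (outside ∷ q) = ∣p∪q∣≤∣p∣+∣q∣ p q

∣p∪q∣≡∣p∣+∣q∣ : ∀ (p q : Subset n) → Disjoint p q → ∣ p ∪ q ∣ ≡ ∣ p ∣ + ∣ q ∣
∣p∪q∣≡∣p∣+∣q∣ []            []            _ = refl
∣p∪q∣≡∣p∣+∣q∣ (inside ∷ p)  (inside ∷ q)  d = ⊥-elim (d (zero , here))
∣p∪q∣≡∣p∣+∣q∣ (inside ∷ p)  (outside ∷ q) d = cong suc (∣p∪q∣≡∣p∣+∣q∣ p q (drop-∷-Empty d))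
∣p∪q∣≡∣p∣+∣q∣ (outside ∷ p) (inside ∷ q)  d =
  trans (cong suc (∣p∪q∣≡∣p∣+∣q∣ p q (drop-∷-Empty d))) (sym (+-suc ∣ p ∣ ∣ q ∣))
∣p∪q∣≡∣p∣+∣q∣ (outside ∷ p) (outside ∷ q) d = ∣p∪q∣≡∣p∣+∣q∣ p q (drop-∷-Empty d)

∣p∩⋃es∣≡length : ∀ (p : Subset n) {es} → All (λ e → ∣ p ∩ e ∣ ≡ 1) es → AllPairs Disjoint es →
                 ∣ p ∩ ⋃ es ∣ ≡ length es
∣p∩⋃es∣≡length {n} p []                 []          = trans (cong ∣_∣ (∩-zeroʳ p)) (∣⊥∣≡0 n)
∣p∩⋃es∣≡length p {e ∷ es} (∣p∩e∣≡1 ∷ ones) (e-apart ∷ apart) = begin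
  ∣ p ∩ (e ∪ ⋃ es) ∣         ≡⟨ cong ∣_∣ (∩-distribˡ-∪ p e (⋃ es)) ⟩
  ∣ (p ∩ e) ∪ (p ∩ ⋃ es) ∣   ≡⟨ ∣p∪q∣≡∣p∣+∣q∣ (p ∩ e) (p ∩ ⋃ es) p∩e-apart ⟩
  ∣ p ∩ e ∣ + ∣ p ∩ ⋃ es ∣   ≡⟨ cong₂ _+_ ∣p∩e∣≡1 (∣p∩⋃es∣≡length p ones apart) ⟩
  suc (length es)            ∎
  where
  open ≡-Reasoning
  p∩e-apart : Disjoint (p ∩ e) (p ∩ ⋃ es)
  p∩e-apart = Disjoint-mono (p∩q⊆q p e) (p∩q⊆q p (⋃ es)) (Disjoint-⋃⁺ e-apart)

∣p∣≡∣p∩q∣+∣p∩∁q∣ : ∀ (p q : Subset n) → ∣ p ∣ ≡ ∣ p ∩ q ∣ + ∣ p ∩ ∁ q ∣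
∣p∣≡∣p∩q∣+∣p∩∁q∣ p q = begin
  ∣ p ∣                         ≡⟨ cong ∣_∣ (sym (∩-identityʳ p)) ⟩
  ∣ p ∩ ⊤ ∣                     ≡⟨ cong (λ r → ∣ p ∩ r ∣) (sym (p∪∁p≡⊤ q)) ⟩
  ∣ p ∩ (q ∪ ∁ q) ∣             ≡⟨ cong ∣_∣ (∩-distribˡ-∪ p q (∁ q)) ⟩
  ∣ (p ∩ q) ∪ (p ∩ ∁ q) ∣       ≡⟨ ∣p∪q∣≡∣p∣+∣q∣ (p ∩ q) (p ∩ ∁ q) apart ⟩
  ∣ p ∩ q ∣ + ∣ p ∩ ∁ q ∣       ∎
  where
  open ≡-Reasoning
  apart : Disjoint (p ∩ q) (p ∩ ∁ q)
  apart = Disjoint-mono (p∩q⊆q p q) (p∩q⊆q p (∁ q)) (Disjoint⁺ λ x∈q x∈∁q → x∈∁p⇒x∉p x∈∁q x∈q)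

∣p∩q∣≥∣p∣∸t : ∀ (p q : Subset n) {t} → ∣ p ∩ ∁ q ∣ ≤ t → ∣ p ∩ q ∣ ≥ ∣ p ∣ ∸ t
∣p∩q∣≥∣p∣∸t p q {t} ∣p∩∁q∣≤t = m≤n+o⇒m∸n≤o ∣ p ∣ t (begin
  ∣ p ∣                     ≡⟨ ∣p∣≡∣p∩q∣+∣p∩∁q∣ p q ⟩
  ∣ p ∩ q ∣ + ∣ p ∩ ∁ q ∣   ≤⟨ +-monoʳ-≤ ∣ p ∩ q ∣ ∣p∩∁q∣≤t ⟩
  ∣ p ∩ q ∣ + t             ≡⟨ +-comm ∣ p ∩ q ∣ t ⟩
  t + ∣ p ∩ q ∣             ∎)
  where open ≤-Reasoning

p∩∁q⊆r⇒p⊆q∪r : ∀ {p q r : Subset n} → p ∩ ∁ q ⊆ r → p ⊆ q ∪ r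
p∩∁q⊆r⇒p⊆q∪r {p = p} {q} {r} p∖q⊆r {x} x∈p with x ∈? q
... | yes x∈q = p⊆p∪q r x∈q
... | no  x∉q = q⊆p∪q q r (p∖q⊆r (x∈p∩q⁺ (x∈p , x∉p⇒x∈∁p x∉q)))

⁅x⁆∪p∩∁q⊆p : ∀ {x} {p q : Subset n} → x ∈ q → (⁅ x ⁆ ∪ p) ∩ ∁ q ⊆ p
⁅x⁆∪p∩∁q⊆p {x = x} {p} {q} x∈q y∈ with x∈p∩q⁻ (⁅ x ⁆ ∪ p) (∁ q) y∈
... | y∈⁅x⁆∪p , y∈∁q with x∈p∪q⁻ ⁅ x ⁆ p y∈⁅x⁆∪p
...   | inj₁ y∈⁅x⁆ = ⊥-elim (x∈∁p⇒x∉p y∈∁q (subst (_∈ q) (sym (x∈⁅y⁆⇒x≡y x y∈⁅x⁆)) x∈q))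
...   | inj₂ y∈p   = y∈p

subset-of-size : ∀ {t} (p : Subset n) → t ≤ ∣ p ∣ → ∃[ X ] X ⊆ p × ∣ X ∣ ≡ t
subset-of-size {n} {zero}  p             _        = ⊥ , ⊥⊆ , ∣⊥∣≡0 n
subset-of-size {t = suc t} (inside ∷ p)  (s≤s t≤) =
  let (X , X⊆p , ∣X∣≡t) = subset-of-size p t≤ in inside ∷ X , s⊆s X⊆p , cong suc ∣X∣≡t
subset-of-size {t = suc t} (outside ∷ p) t≤       =
  let (X , X⊆p , ∣X∣≡t) = subset-of-size p t≤ in outside ∷ X , s⊆s X⊆p , ∣X∣≡t

count : ∀ {A : Set} → (A → Bool) → List A → ℕ
count p xs = length (filterᵇ p xs)

module _ {A : Set} where

  count-++ : ∀ (p : A → Bool) xs ys → count p (xs ++ ys) ≡ count p xs + count p ys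
  count-++ p xs ys = trans (cong length (filter-++ (T? ∘ p) xs ys)) (length-++ (filterᵇ p xs))

  count-map : ∀ {B : Set} (p : B → Bool) (f : A → B) xs → count p (map f xs) ≡ count (p ∘ f) xs
  count-map p f []       = refl
  count-map p f (x ∷ xs) with p (f x)
  ... | true  = cong suc (count-map p f xs)
  ... | false = count-map p f xs

  count-none : ∀ {p : A → Bool} → (∀ x → ¬ T (p x)) → ∀ xs → count p xs ≡ 0
  count-none      none []       = refl
  count-none {p} none (x ∷ xs) with p x | none x
  ... | true  | ¬px = ⊥-elim (¬px _)
  ... | false | _   = count-none none xs

  count-mono : ∀ {p q : A → Bool} → (∀ x → T (p x) → T (q x)) → ∀ xs → count p xs ≤ count q xs
  count-mono         p⇒q []       = z≤n
  count-mono {p} {q} p⇒q (x ∷ xs) with p x | q x | p⇒q x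
  ... | true  | true  | _   = s≤s (count-mono p⇒q xs)
  ... | true  | false | px⇒ = ⊥-elim (px⇒ _)
  ... | false | true  | _   = m≤n⇒m≤1+n (count-mono p⇒q xs)
  ... | false | false | _   = count-mono p⇒q xs

  count-∨ : ∀ (q r : A → Bool) xs → count (λ x → q x ∨ r x) xs ≤ count q xs + count r xs
  count-∨ q r []       = z≤n
  count-∨ q r (x ∷ xs) with q x | r x
  ... | true  | true  = s≤s (≤-trans (count-∨ q r xs) (+-monoʳ-≤ (count q xs) (n≤1+n _)))
  ... | true  | false = s≤s (count-∨ q r xs)
  ... | false | true  = ≤-trans (s≤s (count-∨ q r xs)) (≤-reflexive (sym (+-suc _ _)))
  ... | false | false = count-∨ q r xs

  count-≤-+ : ∀ {p q r : A → Bool} → (∀ x → T (p x) → T (q x) ⊎ T (r x)) →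
              ∀ xs → count p xs ≤ count q xs + count r xs
  count-≤-+ {q = q} {r} split xs =
    ≤-trans (count-mono (λ x px → Equivalence.from T-∨ (split x px)) xs) (count-∨ q r xs)

  count>0⇒∃ : ∀ {p : A → Bool} xs → 0 < count p xs → ∃[ x ] T (p x)
  count>0⇒∃ []       ()
  count>0⇒∃ {p} (x ∷ xs) pos with p x in eq
  ... | true  = x , subst T (sym eq) _
  ... | false = count>0⇒∃ xs pos

count-tabulate : ∀ {A : Set} (p : A → Bool) (f : Fin n → A) → count p (tabulate f) ≡ ∣ Vec.tabulate (p ∘ f) ∣
count-tabulate {zero}  p f = refl
count-tabulate {suc n} p f with p (f zero)
... | true  = cong suc (count-tabulate p (f ∘ suc))
... | false = count-tabulate p (f ∘ suc)

count-allFin : ∀ (S : Subset n) → count (lookup S) (allFin n) ≡ ∣ S ∣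
count-allFin S = trans (count-tabulate (lookup S) id) (cong ∣_∣ (tabulate∘lookup S))

_⊗_ : (Fin n → Bool) → (Vec (Fin n) k → Bool) → Vec (Fin n) (suc k) → Bool
(p ⊗ q) (x ∷ xs) = p x ∧ q xs

count-⊗ : ∀ (p : Fin n → Bool) (q : Vec (Fin n) k → Bool) →
          count (p ⊗ q) (allTuples (suc k)) ≡ count p (allFin n) * count q (allTuples k)
count-⊗ {n} {k} p q = go (allFin n)
  where
  rows : Fin n → List (Vec (Fin n) (suc k))
  rows x = map (x ∷_) (allTuples k)
  go : ∀ xs → count (p ⊗ q) (concatMap rows xs) ≡ count p xs * count q (allTuples k)
  go []       = refl
  go (x ∷ xs) rewrite count-++ (p ⊗ q) (rows x) (concatMap rows xs)
                    | count-map (p ⊗ q) (x ∷_) (allTuples k)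
                    | go xs
                    with p x
  ... | true  = refl
  ... | false = cong (_+ count p xs * count q (allTuples k)) (count-none (λ _ ()) (allTuples k))

count-lookup-⊗ : ∀ (S : Subset n) (q : Vec (Fin n) k → Bool) →
                 count (lookup S ⊗ q) (allTuples (suc k)) ≡ ∣ S ∣ * count q (allTuples k)
count-lookup-⊗ {k = k} S q = trans (count-⊗ (lookup S) q) (cong (_* count q (allTuples k)) (count-allFin S))

lookup∈toSet : ∀ (xs : Vec (Fin n) k) i → lookup xs i ∈ toSet xs
lookup∈toSet (x ∷ xs) zero    = p⊆p∪q (toSet xs) (x∈⁅x⁆ x)
lookup∈toSet (x ∷ xs) (suc i) = q⊆p∪q ⁅ x ⁆ (toSet xs) (lookup∈toSet xs i)

∈toSet⇒ : ∀ {y} (xs : Vec (Fin n) k) → y ∈ toSet xs → ∃[ i ] lookup xs i ≡ y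
∈toSet⇒ []       y∈⊥ = ⊥-elim (∉⊥ y∈⊥)
∈toSet⇒ (x ∷ xs) y∈ with x∈p∪q⁻ ⁅ x ⁆ (toSet xs) y∈
... | inj₁ y∈⁅x⁆ = zero , sym (x∈⁅y⁆⇒x≡y x y∈⁅x⁆)
... | inj₂ y∈xs  = let (i , xsᵢ≡y) = ∈toSet⇒ xs y∈xs in suc i , xsᵢ≡y

∣toSet∣≤ : ∀ (xs : Vec (Fin n) k) → ∣ toSet xs ∣ ≤ k
∣toSet∣≤ {n} []       = ≤-reflexive (∣⊥∣≡0 n)
∣toSet∣≤ (x ∷ xs) = begin
  ∣ ⁅ x ⁆ ∪ toSet xs ∣         ≤⟨ ∣p∪q∣≤∣p∣+∣q∣ ⁅ x ⁆ (toSet xs) ⟩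
  ∣ ⁅ x ⁆ ∣ + ∣ toSet xs ∣     ≡⟨ cong (_+ ∣ toSet xs ∣) (∣⁅x⁆∣≡1 x) ⟩
  suc ∣ toSet xs ∣             ≤⟨ s≤s (∣toSet∣≤ xs) ⟩
  suc _                        ∎
  where open ≤-Reasoning

inTupleᵇ⁺ : ∀ (X : Vec (Subset n) k) xs → (∀ i → lookup xs i ∈ lookup X i) → T (inTupleᵇ X xs)
inTupleᵇ⁺ []      []       _  = _
inTupleᵇ⁺ (S ∷ X) (x ∷ xs) xs∈X = Equivalence.from T-∧ (∈⇒T (xs∈X zero) , inTupleᵇ⁺ X xs (xs∈X ∘ suc))

inTupleᵇ⁻ : ∀ (X : Vec (Subset n) k) xs → T (inTupleᵇ X xs) → ∀ i → lookup xs i ∈ lookup X i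
inTupleᵇ⁻ (S ∷ X) (x ∷ xs) h zero    = T⇒∈ (proj₁ (Equivalence.to T-∧ h))
inTupleᵇ⁻ (S ∷ X) (x ∷ xs) h (suc i) = inTupleᵇ⁻ X xs (proj₂ (Equivalence.to (T-∧ {lookup S x}) h)) i

allTuples-complete : ∀ (xs : Vec (Fin n) k) → xs ∈ₗ allTuples k
allTuples-complete []       = Any.here refl
allTuples-complete (x ∷ xs) =
  ∈-concatMap⁺ (λ y → map (y ∷_) (allTuples _)) (lose (∈-allFin x) (∈-map⁺ (x ∷_) (allTuples-complete xs)))

PairwiseDisjoint : Vec (Subset n) k → Set
PairwiseDisjoint V = ∀ i j → i ≢ j → Disjoint (lookup V i) (lookup V j)

module _ {e : Subset n} where

  Crosses-mono : ∀ {X Y : Vec (Subset n) k} → (∀ i → lookup X i ⊆ lookup Y i) → Crosses e X → Crosses e Y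
  Crosses-mono X⊆Y (xs , xs∈X , xs≡e) = xs , (λ i → X⊆Y i (xs∈X i)) , xs≡e

  Crosses⇒Nonempty : ∀ {X : Vec (Subset n) (suc k)} → Crosses e X → Nonempty e
  Crosses⇒Nonempty (xs , _ , refl) = lookup xs zero , lookup∈toSet xs zero

  Crosses⇒Disjoint : ∀ {f} {X : Vec (Subset n) k} →
                     (∀ i → Disjoint (lookup X i) f) → Crosses e X → Disjoint e f
  Crosses⇒Disjoint Xᵢ-apart (xs , xs∈X , refl) = Disjoint⁺ λ y∈xs y∈f →
    case ∈toSet⇒ xs y∈xs of λ { (i , refl) → Disjoint⁻ (Xᵢ-apart i) (xs∈X i) y∈f }

  ∣Vᵢ∩e∣≡1 : ∀ {V : Vec (Subset n) k} → PairwiseDisjoint V → Crosses e V → ∀ i → ∣ lookup V i ∩ e ∣ ≡ 1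
  ∣Vᵢ∩e∣≡1 {V = V} V-disjoint (xs , xs∈V , refl) i =
    trans (cong ∣_∣ (⊆-antisym Vᵢ∩xs⊆⁅xsᵢ⁆ ⁅xsᵢ⁆⊆Vᵢ∩xs)) (∣⁅x⁆∣≡1 (lookup xs i))
    where
    Vᵢ∩xs⊆⁅xsᵢ⁆ : lookup V i ∩ toSet xs ⊆ ⁅ lookup xs i ⁆
    Vᵢ∩xs⊆⁅xsᵢ⁆ y∈ with x∈p∩q⁻ (lookup V i) (toSet xs) y∈
    ... | y∈Vᵢ , y∈xs with ∈toSet⇒ xs y∈xs
    ...   | j , refl with i ≟ j
    ...     | yes refl = x∈⁅x⁆ (lookup xs i)
    ...     | no  i≢j  = ⊥-elim (Disjoint⁻ (V-disjoint i j i≢j) y∈Vᵢ (xs∈V j))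
    ⁅xsᵢ⁆⊆Vᵢ∩xs : ⁅ lookup xs i ⁆ ⊆ lookup V i ∩ toSet xs
    ⁅xsᵢ⁆⊆Vᵢ∩xs y∈ rewrite x∈⁅y⁆⇒x≡y _ y∈ = x∈p∩q⁺ (xs∈V i , lookup∈toSet xs i)

crossings-apart : ∀ {r s} {V : Vec (Subset n) r} {U : Vec (Subset n) s} {W e′ e″} →
                  (∀ i j → Disjoint (lookup U i) (lookup V j)) →
                  Crosses e′ V → Disjoint W e′ → Crosses e″ (W ∷ U) → Disjoint e′ e″
crossings-apart {V = V} {U} {W} {e′} UV-disjoint e′-crosses W-apart-e′ e″-crosses =
  Disjoint-sym (Crosses⇒Disjoint {X = W ∷ U} W∷U-apart-e′ e″-crosses)
  where
  W∷U-apart-e′ : ∀ i → Disjoint (lookup (W ∷ U) i) e′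
  W∷U-apart-e′ zero    = W-apart-e′
  W∷U-apart-e′ (suc i) =
    Disjoint-sym (Crosses⇒Disjoint {X = V} (λ j → Disjoint-sym (UV-disjoint i j)) e′-crosses)

-- Greedy maximal matchings

Transversal : ∀ {r} → Hypergraph n r → Vec (Subset n) r → Subset n → Set
Transversal G V C = ∀ e → IsEdge G e → Crosses e V → Nonempty (e ∩ C)

addIfDisjoint : Subset n → List (Subset n) → List (Subset n)
addIfDisjoint e M with nonempty? (e ∩ ⋃ M)
... | yes _ = M
... | no  _ = e ∷ M

greedyMatching : List (Subset n) → List (Subset n)
greedyMatching = foldr addIfDisjoint []

module _ {e : Subset n} {M : List (Subset n)} where

  addIfDisjoint-All : ∀ {P : Subset n → Set} → P e → All P M → All P (addIfDisjoint e M)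
  addIfDisjoint-All pe pM with nonempty? (e ∩ ⋃ M)
  ... | yes _ = pM
  ... | no  _ = pe ∷ pM

  addIfDisjoint-disjoint : AllPairs Disjoint M → AllPairs Disjoint (addIfDisjoint e M)
  addIfDisjoint-disjoint M-disjoint with nonempty? (e ∩ ⋃ M)
  ... | yes _       = M-disjoint
  ... | no  e-apart = Disjoint-⋃⁻ M e-apart ∷ M-disjoint

  ⋃-addIfDisjoint : ⋃ M ⊆ ⋃ (addIfDisjoint e M)
  ⋃-addIfDisjoint with nonempty? (e ∩ ⋃ M)
  ... | yes _ = id
  ... | no  _ = q⊆p∪q e (⋃ M)

  addIfDisjoint-meets : Nonempty e → Nonempty (e ∩ ⋃ (addIfDisjoint e M))
  addIfDisjoint-meets (x , x∈e) with nonempty? (e ∩ ⋃ M)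
  ... | yes e-meets = e-meets
  ... | no  _       = x , x∈p∩q⁺ (x∈e , p⊆p∪q (⋃ M) x∈e)

greedyMatching-All : ∀ {P : Subset n → Set} {es} → All P es → All P (greedyMatching es)
greedyMatching-All []         = []
greedyMatching-All (pe ∷ pes) = addIfDisjoint-All pe (greedyMatching-All pes)

greedyMatching-disjoint : ∀ (es : List (Subset n)) → AllPairs Disjoint (greedyMatching es)
greedyMatching-disjoint []       = []
greedyMatching-disjoint (e ∷ es) = addIfDisjoint-disjoint (greedyMatching-disjoint es)

greedyMatching-maximal : ∀ (es : List (Subset n)) →
                         All (λ e → Nonempty e → Nonempty (e ∩ ⋃ (greedyMatching es))) es
greedyMatching-maximal []       = []
greedyMatching-maximal (e ∷ es) =
  addIfDisjoint-meets ∷ All.map (λ meets → Nonempty-∩-monoʳ ⋃-addIfDisjoint ∘ meets)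
                                (greedyMatching-maximal es)

module _ (G : Hypergraph n (suc k)) (V : Vec (Subset n) (suc k)) where

  crossingᵇ : Vec (Fin n) (suc k) → Bool
  crossingᵇ xs = inTupleᵇ V xs ∧ edge G (toSet xs)

  crossingEdges : List (Subset n)
  crossingEdges = map toSet (filterᵇ crossingᵇ (allTuples (suc k)))

  crossingEdges-sound : All (λ e → IsEdge G e × Crosses e V) crossingEdges
  crossingEdges-sound = map⁺ (All.map sound (all-filter (T? ∘ crossingᵇ) (allTuples (suc k))))
    where
    sound : ∀ {xs} → T (crossingᵇ xs) → IsEdge G (toSet xs) × Crosses (toSet xs) V
    sound {xs} h = let (xs∈V , xs∈G) = Equivalence.to T-∧ h in xs∈G , xs , inTupleᵇ⁻ V xs xs∈V , refl

  crossingEdges-complete : ∀ {e} → IsEdge G e → Crosses e V → e ∈ₗ crossingEdges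
  crossingEdges-complete e∈G (xs , xs∈V , refl) =
    ∈-map⁺ toSet (∈-filter⁺ (T? ∘ crossingᵇ) (allTuples-complete xs)
                            (Equivalence.from T-∧ (inTupleᵇ⁺ V xs xs∈V , e∈G)))

  maximalMatching : ∃[ M ] IsMatchingIn G V M × Transversal G V (⋃ M)
  maximalMatching =
    M , ((All.map proj₁ M-sound , greedyMatching-disjoint crossingEdges) , All.map proj₂ M-sound) , M-maximal
    where
    M : List (Subset n)
    M = greedyMatching crossingEdges
    M-sound : All (λ e → IsEdge G e × Crosses e V) M
    M-sound = greedyMatching-All crossingEdges-sound
    M-maximal : Transversal G V (⋃ M)
    M-maximal e e∈G e-crosses =
      All.lookup (greedyMatching-maximal crossingEdges) (crossingEdges-complete e∈G e-crosses)
                 (Crosses⇒Nonempty {X = V} e-crosses)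

-- Vertices of V₀ missed by a maximal matching

module _ {G : Hypergraph n (suc k)} {V : Vec (Subset n) (suc k)} {C : Subset n} where

  eG≡0-outside-transversal : Transversal G V C → ∀ X → (∀ i → lookup X i ⊆ lookup V i ∩ ∁ C) → eG G X ≡ 0
  eG≡0-outside-transversal C-meets X X⊆V∖C = count-none no-edge (allTuples (suc k))
    where
    no-edge : ∀ ys → ¬ T (inTupleᵇ X ys ∧ edge G (toSet ys))
    no-edge ys h =
      let (ys∈X , ys∈G) = Equivalence.to T-∧ h
          ys∈V∖C : ∀ i → lookup ys i ∈ lookup V i ∩ ∁ C
          ys∈V∖C i = X⊆V∖C i (inTupleᵇ⁻ X ys ys∈X i)
          (y , y∈ys∩C) = C-meets (toSet ys) ys∈G (ys , (λ i → p∩q⊆p _ _ (ys∈V∖C i)) , refl)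
          (y∈ys , y∈C) = x∈p∩q⁻ (toSet ys) C y∈ys∩C
          (i , ysᵢ≡y)  = ∈toSet⇒ ys y∈ys
      in x∈∁p⇒x∉p (p∩q⊆q _ _ (ys∈V∖C i)) (subst (_∈ C) (sym ysᵢ≡y) y∈C)

uncovered≤ : ∀ {G : Hypergraph n (suc k)} {V : Vec (Subset n) (suc k)} {M m*} →
             PairwiseDisjoint V → (∀ i → ∣ head V ∣ ≤ ∣ lookup V i ∣) → AlphaStarAtMost G V m* →
             IsMatchingIn G V M → Transversal G V (⋃ M) → ∣ head V ∩ ∁ (⋃ M) ∣ ≤ m*
uncovered≤ {n} {k} {G} {V@(V₀ ∷ _)} {M}
           V-disjoint V₀-smallest α≤m* ((_ , M-disjoint) , M-crossing) M-transversal =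
  α≤m* t (X , X⊆V , ∣X∣≡t , eG≡0-outside-transversal {G = G} {V} {C} M-transversal X X⊆V∖C)
  where
  C : Subset n
  C = ⋃ M
  t : ℕ
  t = ∣ V₀ ∩ ∁ C ∣

  ∣Vᵢ∩C∣≡∣M∣ : ∀ i → ∣ lookup V i ∩ C ∣ ≡ length M
  ∣Vᵢ∩C∣≡∣M∣ i = ∣p∩⋃es∣≡length (lookup V i)
    (All.map (λ e-crosses → ∣Vᵢ∩e∣≡1 {V = V} V-disjoint e-crosses i) M-crossing) M-disjoint

  t≤∣Vᵢ∖C∣ : ∀ i → t ≤ ∣ lookup V i ∩ ∁ C ∣
  t≤∣Vᵢ∖C∣ i = +-cancelˡ-≤ (length M) _ _ (begin
    length M + t                              ≡⟨ cong (_+ t) (sym (∣Vᵢ∩C∣≡∣M∣ zero)) ⟩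
    ∣ V₀ ∩ C ∣ + t                            ≡⟨ sym (∣p∣≡∣p∩q∣+∣p∩∁q∣ V₀ C) ⟩
    ∣ V₀ ∣                                    ≤⟨ V₀-smallest i ⟩
    ∣ lookup V i ∣                            ≡⟨ ∣p∣≡∣p∩q∣+∣p∩∁q∣ (lookup V i) C ⟩
    ∣ lookup V i ∩ C ∣ + ∣ lookup V i ∩ ∁ C ∣ ≡⟨ cong (_+ ∣ lookup V i ∩ ∁ C ∣) (∣Vᵢ∩C∣≡∣M∣ i) ⟩
    length M + ∣ lookup V i ∩ ∁ C ∣           ∎)
    where open ≤-Reasoning

  Y : ∀ i → ∃[ Y ] Y ⊆ lookup V i ∩ ∁ C × ∣ Y ∣ ≡ t
  Y i = subset-of-size (lookup V i ∩ ∁ C) (t≤∣Vᵢ∖C∣ i)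

  X : Vec (Subset n) (suc k)
  X = Vec.tabulate (proj₁ ∘ Y)

  X⊆V∖C : ∀ i → lookup X i ⊆ lookup V i ∩ ∁ C
  X⊆V∖C i rewrite lookup∘tabulate (proj₁ ∘ Y) i = proj₁ (proj₂ (Y i))

  X⊆V : ∀ i → lookup X i ⊆ lookup V i
  X⊆V i x∈ = p∩q⊆p (lookup V i) (∁ C) (X⊆V∖C i x∈)

  ∣X∣≡t : ∀ i → ∣ lookup X i ∣ ≡ t
  ∣X∣≡t i rewrite lookup∘tabulate (proj₁ ∘ Y) i = proj₂ (proj₂ (Y i))

-- Tuples of U₁ × ⋯ × U_k meeting a set

meetsᵇ : Subset n → Vec (Fin n) k → Bool
meetsᵇ B []       = false
meetsᵇ B (x ∷ xs) = lookup B x ∨ meetsᵇ B xs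

meetingᵇ : Vec (Subset n) k → Subset n → Vec (Fin n) k → Bool
meetingᵇ U B xs = inTupleᵇ U xs ∧ meetsᵇ B xs

¬meetsᵇ⇒Disjoint : ∀ B (xs : Vec (Fin n) k) → T (not (meetsᵇ B xs)) → Disjoint (toSet xs) B
¬meetsᵇ⇒Disjoint B []       _ = Disjoint⁺ λ y∈⊥ _ → ∉⊥ y∈⊥
¬meetsᵇ⇒Disjoint B (x ∷ xs) h with lookup B x in x∉B
... | false = Disjoint-∪ˡ (Disjoint-⁅x⁆ λ x∈B → subst T x∉B (∈⇒T x∈B)) (¬meetsᵇ⇒Disjoint B xs h)

count-inTupleᵇ≤ : ∀ {m} (U : Vec (Subset n) k) → (∀ i → ∣ lookup U i ∣ ≤ m) →
                  count (inTupleᵇ U) (allTuples k) ≤ m ^ k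
count-inTupleᵇ≤ []      _ = ≤-refl
count-inTupleᵇ≤ {n} {suc k} {m} (S ∷ U) ∣U∣≤m = begin
  count (inTupleᵇ (S ∷ U)) (allTuples (suc k))
    ≤⟨ count-mono {p = inTupleᵇ (S ∷ U)} {lookup S ⊗ inTupleᵇ U} (λ { (x ∷ xs) h → h }) (allTuples (suc k)) ⟩
  count (lookup S ⊗ inTupleᵇ U) (allTuples (suc k))
    ≡⟨ count-lookup-⊗ S (inTupleᵇ U) ⟩
  ∣ S ∣ * count (inTupleᵇ U) (allTuples k)
    ≤⟨ *-mono-≤ (∣U∣≤m zero) (count-inTupleᵇ≤ U (∣U∣≤m ∘ suc)) ⟩
  m * m ^ k
    ∎
  where open ≤-Reasoning

-- Multiplied by m so that the bound k · m^(k-1) · |B| needs no division.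
count-meetsᵇ≤ : ∀ {m} (U : Vec (Subset n) k) B → (∀ i → ∣ lookup U i ∣ ≤ m) →
                count (meetingᵇ U B) (allTuples k) * m ≤ k * m ^ k * ∣ B ∣
count-meetsᵇ≤ [] B _ = z≤n
count-meetsᵇ≤ {n} {suc k} {m} (S ∷ U) B ∣U∣≤m = begin
  count (meetingᵇ (S ∷ U) B) (allTuples (suc k)) * m
    ≤⟨ *-monoˡ-≤ m (count-≤-+ split (allTuples (suc k))) ⟩
  (count (lookup B ⊗ inTupleᵇ U) (allTuples (suc k))
    + count (lookup S ⊗ meetingᵇ U B) (allTuples (suc k))) * m
    ≡⟨ cong (_* m) (cong₂ _+_ (count-lookup-⊗ B (inTupleᵇ U)) (count-lookup-⊗ S (meetingᵇ U B))) ⟩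
  (∣ B ∣ * tuples + ∣ S ∣ * meeting) * m
    ≡⟨ distribute (∣ B ∣) tuples (∣ S ∣) meeting m ⟩
  ∣ B ∣ * tuples * m + ∣ S ∣ * (meeting * m)
    ≤⟨ +-mono-≤ (*-monoˡ-≤ m (*-monoʳ-≤ ∣ B ∣ (count-inTupleᵇ≤ U (∣U∣≤m ∘ suc))))
                (*-mono-≤ (∣U∣≤m zero) (count-meetsᵇ≤ U B (∣U∣≤m ∘ suc))) ⟩
  ∣ B ∣ * m ^ k * m + m * (k * m ^ k * ∣ B ∣)
    ≡⟨ collect (∣ B ∣) (m ^ k) m k ⟩
  suc k * (m * m ^ k) * ∣ B ∣
    ∎
  where
  open ≤-Reasoning
  tuples meeting : ℕ
  tuples  = count (inTupleᵇ U) (allTuples k)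
  meeting = count (meetingᵇ U B) (allTuples k)
  split : ∀ xs → T (meetingᵇ (S ∷ U) B xs) → T ((lookup B ⊗ inTupleᵇ U) xs) ⊎ T ((lookup S ⊗ meetingᵇ U B) xs)
  split (x ∷ xs) h with lookup S x | inTupleᵇ U xs | lookup B x | meetsᵇ B xs
  ... | true  | true  | true  | _     = inj₁ _
  ... | true  | true  | false | true  = inj₂ _
  ... | true  | true  | false | false = ⊥-elim h
  ... | true  | false | _     | _     = ⊥-elim h
  ... | false | _     | _     | _     = ⊥-elim h
  distribute : ∀ b t s h m → (b * t + s * h) * m ≡ b * t * m + s * (h * m)
  distribute = solve-∀
  collect : ∀ b p m k → b * p * m + m * (k * p * b) ≡ suc k * (m * p) * b
  collect = solve-∀

module _ (G : Hypergraph n (suc k)) (U : Vec (Subset n) k) (w : Fin n) (B : Subset n) where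

  avoidingLinkᵇ : Vec (Fin n) k → Bool
  avoidingLinkᵇ ys = (inTupleᵇ U ys ∧ edge G (toSet (w ∷ ys))) ∧ not (meetsᵇ B ys)

  dG≤avoiding+meeting : dG G w U ≤ count avoidingLinkᵇ (allTuples k) + count (meetingᵇ U B) (allTuples k)
  dG≤avoiding+meeting = begin
    dG G w U
      ≤⟨ count-≤-+ split (allTuples (suc k)) ⟩
    count (lookup ⁅ w ⁆ ⊗ avoidingLinkᵇ) (allTuples (suc k))
      + count (lookup ⁅ w ⁆ ⊗ meetingᵇ U B) (allTuples (suc k))
      ≡⟨ cong₂ _+_ (centred avoidingLinkᵇ) (centred (meetingᵇ U B)) ⟩
    count avoidingLinkᵇ (allTuples k) + count (meetingᵇ U B) (allTuples k)
      ∎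
    where
    open ≤-Reasoning
    centred : ∀ q → count (lookup ⁅ w ⁆ ⊗ q) (allTuples (suc k)) ≡ count q (allTuples k)
    centred q = trans (count-lookup-⊗ ⁅ w ⁆ q)
                      (trans (cong (_* count q (allTuples k)) (∣⁅x⁆∣≡1 w)) (*-identityˡ _))
    split : ∀ xs → T (inTupleᵇ (⁅ w ⁆ ∷ U) xs ∧ edge G (toSet xs)) →
            T ((lookup ⁅ w ⁆ ⊗ avoidingLinkᵇ) xs) ⊎ T ((lookup ⁅ w ⁆ ⊗ meetingᵇ U B) xs)
    split (x ∷ ys) h with x∈⁅y⁆⇒x≡y w (T⇒∈ (proj₁ (Equivalence.to T-∧ (proj₁ (Equivalence.to T-∧ h)))))
    ... | refl with lookup ⁅ w ⁆ w | inTupleᵇ U ys | edge G (toSet (w ∷ ys)) | meetsᵇ B ys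
    ...   | true  | true  | true  | false = inj₁ _
    ...   | true  | true  | true  | true  = inj₂ _
    ...   | true  | true  | false | _     = ⊥-elim h
    ...   | true  | false | _     | _     = ⊥-elim h
    ...   | false | _     | _     | _     = ⊥-elim h

avoidingLink : ∀ {m m* j} (G : Hypergraph n (suc (suc k))) (U : Vec (Subset n) (suc k)) w B → .{{NonZero m}} →
               (∀ i → ∣ lookup U i ∣ ≤ m) → dG G w U ≥ suc k * suc k * m ^ k * m* →
               ∣ B ∣ ≤ suc k * j → j < m* →
               ∃[ ys ] (∀ i → lookup ys i ∈ lookup U i) × IsEdge G (toSet (w ∷ ys)) × Disjoint (toSet ys) B
avoidingLink {n} {k} {m} {m*} {j} G U w B ∣U∣≤m deg ∣B∣≤ j<m*
  with count>0⇒∃ (allTuples (suc k)) (n≢0⇒n>0 λ none → <⇒≱ j<m* (m*≤j none))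
  where
  K : ℕ
  K = suc k
  m*≤j : count (avoidingLinkᵇ G U w B) (allTuples K) ≡ 0 → m* ≤ j
  m*≤j none = *-cancelˡ-≤ (K * K * m ^ K) {{m*n≢0 (K * K) (m ^ K) {{_}} {{m^n≢0 m K}}}} (begin
    K * K * m ^ K * m*                                        ≡⟨ shift K (m ^ k) m m* ⟩
    K * K * m ^ k * m* * m                                    ≤⟨ *-monoˡ-≤ m deg ⟩
    dG G w U * m                                              ≤⟨ *-monoˡ-≤ m (dG≤avoiding+meeting G U w B) ⟩
    (count (avoidingLinkᵇ G U w B) (allTuples K) + meeting) * m ≡⟨ cong (λ a → (a + meeting) * m) none ⟩
    meeting * m                                               ≤⟨ count-meetsᵇ≤ U B ∣U∣≤m ⟩
    K * m ^ K * ∣ B ∣                                          ≤⟨ *-monoʳ-≤ (K * m ^ K) ∣B∣≤ ⟩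
    K * m ^ K * (K * j)                                       ≡⟨ swap K (m ^ K) j ⟩
    K * K * m ^ K * j                                         ∎)
    where
    open ≤-Reasoning
    meeting : ℕ
    meeting = count (meetingᵇ U B) (allTuples K)
    shift : ∀ K p m m* → K * K * (m * p) * m* ≡ K * K * p * m* * m
    shift = solve-∀
    swap : ∀ K p j → K * p * (K * j) ≡ K * K * p * j
    swap = solve-∀
... | ys , h =
  let (link , avoids) = Equivalence.to T-∧ h
      (ys∈U , ys∈G)   = Equivalence.to T-∧ link
  in ys , inTupleᵇ⁻ U ys ys∈U , ys∈G , ¬meetsᵇ⇒Disjoint B ys avoids

-- Completing the matching through U

module _ (G : Hypergraph n (suc (suc k))) (W : Subset n) (U : Vec (Subset n) (suc k))
         {m m* : ℕ} .{{_ : NonZero m}}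
         (U-apart : ∀ i → Disjoint (lookup U i) W) (∣U∣≤m : ∀ i → ∣ lookup U i ∣ ≤ m)
         (deg : ∀ w → w ∈ W → dG G w U ≥ suc k * suc k * m ^ k * m*) where

  record PartialCompletion (ws : List (Fin n)) : Set where
    field
      M        : List (Subset n)
      matching : IsMatching G M
      crossing : All (λ e → Crosses e (W ∷ U)) M
      tails    : ∣ ⋃ M ∩ ∁ W ∣ ≤ suc k * length M
      short    : length M ≤ length ws
      covers   : All (_∈ ⋃ M) ws

  private
    empty : PartialCompletion []
    empty = record
      { M        = []
      ; matching = [] , []
      ; crossing = []
      ; tails    = ≤-trans (≤-reflexive (trans (cong ∣_∣ (∩-zeroˡ (∁ W))) (∣⊥∣≡0 n))) z≤n
      ; short    = z≤n
      ; covers   = []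
      }

    -- Unreachable when ws has no repetitions; allowing it spares a uniqueness invariant.
    skip : ∀ {w ws} (p : PartialCompletion ws) → w ∈ ⋃ (PartialCompletion.M p) → PartialCompletion (w ∷ ws)
    skip p w∈M = record
      { M        = M
      ; matching = matching
      ; crossing = crossing
      ; tails    = tails
      ; short    = m≤n⇒m≤1+n short
      ; covers   = w∈M ∷ covers
      }
      where open PartialCompletion p

    add : ∀ {w ws} → w ∈ W → (p : PartialCompletion ws) → w ∉ ⋃ (PartialCompletion.M p) → length ws < m* →
          PartialCompletion (w ∷ ws)
    add {w} w∈W p w∉M ∣ws∣<m*
      with avoidingLink G U w (⋃ M ∩ ∁ W) ∣U∣≤m (deg w w∈W) tails (≤-<-trans short ∣ws∣<m*)
      where open PartialCompletion p
    ... | ys , ys∈U , e∈G , ys-avoids = record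
      { M        = e ∷ M
      ; matching = (e∈G ∷ proj₁ matching) , (Disjoint-⋃⁻ M e-apart ∷ proj₂ matching)
      ; crossing = (w ∷ ys , (λ { zero → w∈W ; (suc i) → ys∈U i }) , refl) ∷ crossing
      ; tails    = tails′
      ; short    = s≤s short
      ; covers   = p⊆p∪q (⋃ M) (lookup∈toSet (w ∷ ys) zero) ∷ All.map (q⊆p∪q e (⋃ M)) covers
      }
      where
      open PartialCompletion p
      e : Subset n
      e = toSet (w ∷ ys)
      e-apart : Disjoint e (⋃ M)
      e-apart = Disjoint-∪ˡ (Disjoint-⁅x⁆ w∉M)
                            (Disjoint-∩∁ ys-avoids (Crosses⇒Disjoint {X = U} U-apart (ys , ys∈U , refl)))
      tails′ : ∣ (e ∪ ⋃ M) ∩ ∁ W ∣ ≤ suc k * suc (length M)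
      tails′ = begin
        ∣ (e ∪ ⋃ M) ∩ ∁ W ∣           ≡⟨ cong ∣_∣ (∩-distribʳ-∪ (∁ W) e (⋃ M)) ⟩
        ∣ (e ∩ ∁ W) ∪ (⋃ M ∩ ∁ W) ∣   ≤⟨ ∣p∪q∣≤∣p∣+∣q∣ (e ∩ ∁ W) (⋃ M ∩ ∁ W) ⟩
        ∣ e ∩ ∁ W ∣ + ∣ ⋃ M ∩ ∁ W ∣   ≤⟨ +-mono-≤ (≤-trans (p⊆q⇒∣p∣≤∣q∣ (⁅x⁆∪p∩∁q⊆p w∈W)) (∣toSet∣≤ ys)) tails ⟩
        suc k + suc k * length M      ≡⟨ sym (*-suc (suc k) (length M)) ⟩
        suc k * suc (length M)        ∎
        where open ≤-Reasoning

    extend : ∀ {w ws} → w ∈ W → PartialCompletion ws → length ws < m* → PartialCompletion (w ∷ ws)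
    extend {w} w∈W p ∣ws∣<m* with w ∈? ⋃ (PartialCompletion.M p)
    ... | yes w∈M = skip p w∈M
    ... | no  w∉M = add w∈W p w∉M ∣ws∣<m*

    build : ∀ ws → All (_∈ W) ws → length ws ≤ m* → PartialCompletion ws
    build []       []            _         = empty
    build (w ∷ ws) (w∈W ∷ ws⊆W) ∣w∷ws∣≤m* = extend w∈W (build ws ws⊆W (<⇒≤ ∣w∷ws∣≤m*)) ∣w∷ws∣≤m*

  completion : ∣ W ∣ ≤ m* → ∃[ M ] IsMatching G M × length M ≤ m* × All (λ e → Crosses e (W ∷ U)) M × W ⊆ ⋃ M
  completion ∣W∣≤m* = M , matching , ≤-trans short ∣ws∣≤m* , crossing , W⊆⋃M
    where
    ws : List (Fin n)
    ws = filterᵇ (lookup W) (allFin n)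
    ∣ws∣≤m* : length ws ≤ m*
    ∣ws∣≤m* = subst (_≤ m*) (sym (count-allFin W)) ∣W∣≤m*
    open PartialCompletion (build ws (All.map T⇒∈ (all-filter (T? ∘ lookup W) (allFin n))) ∣ws∣≤m*)
    W⊆⋃M : W ⊆ ⋃ M
    W⊆⋃M x∈W = All.lookup covers (∈-filter⁺ (T? ∘ lookup W) (∈-allFin _) (∈⇒T x∈W))

matching-++ : ∀ {r} {G : Hypergraph n r} {M N} → IsMatching G M → IsMatching G N →
              All (λ e → All (Disjoint e) N) M → IsMatching G (M ++ N)
matching-++ (M-edges , M-disjoint) (N-edges , N-disjoint) M-apart-N =
  All-++⁺ M-edges N-edges , AllPairs.++⁺ M-disjoint N-disjoint M-apart-N

lemma3p1 : (n k : ℕ) → 1 ≤ k → (G : Hypergraph n (suc k))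
    → (V : Vec (Subset n) (suc k)) → (U : Vec (Subset n) k) → (m m* : ℕ)
    → (∀ i j → i ≢ j → Disjoint (lookup V i) (lookup V j))
    → (∀ i → ∣ lookup U i ∣ ≡ m)
    → (∀ i j → Disjoint (lookup U i) (lookup V j))
    → 1 ≤ m* → m* ≤ m
    → (∀ i → ∣ head V ∣ ≤ ∣ lookup V i ∣)
    → AlphaStarAtMost G V m*
    → Σ (List (Subset n)) λ M′ →
        IsMatchingIn G V M′
        × ∣ head V ∩ ⋃ M′ ∣ ≥ ∣ head V ∣ ∸ m*
        × ((∀ v → v ∈ head V → dG G v U ≥ k * k * m ^ (k ∸ 1) * m*)
           → Σ (List (Subset n)) λ M″ →
               IsMatching G M″
               × length M″ ≤ m*
               × All (λ e → Crosses e (head V ∷ U)) M″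
               × IsMatching G (M′ ++ M″)
               × head V ⊆ ⋃ (M′ ++ M″))
lemma3p1 n (suc k) _ G V@(V₀ ∷ _) U m m* V-disjoint ∣U∣≡m UV-disjoint 1≤m* m*≤m V₀-smallest α≤m*
  with maximalMatching G V
... | M′ , M′-in-G[V]@(M′-matching , M′-crossing) , M′-maximal =
  M′ , M′-in-G[V] , ∣p∩q∣≥∣p∣∸t V₀ C uncovered , λ deg →
    let (M″ , M″-matching , ∣M″∣≤m* , M″-crossing , W⊆⋃M″) =
          completion G W U {{>-nonZero (≤-trans 1≤m* m*≤m)}} U-apart-W (≤-reflexive ∘ ∣U∣≡m)
                     (λ w → deg w ∘ p∩q⊆p V₀ (∁ C)) uncovered
    in M″ , M″-matching , ∣M″∣≤m* , All.map (Crosses-mono {X = W ∷ U} {V₀ ∷ U} W∷U⊆V₀∷U) M″-crossing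
     , matching-++ {G = G} M′-matching M″-matching (M′-apart-M″ M″-crossing)
     , subst (V₀ ⊆_) (sym (⋃-++ M′ M″)) (p∩∁q⊆r⇒p⊆q∪r W⊆⋃M″)
  where
  C W : Subset n
  C = ⋃ M′
  W = V₀ ∩ ∁ C

  uncovered : ∣ W ∣ ≤ m*
  uncovered = uncovered≤ {G = G} {V} V-disjoint V₀-smallest α≤m* M′-in-G[V] M′-maximal

  U-apart-W : ∀ i → Disjoint (lookup U i) W
  U-apart-W i = Disjoint-mono ⊆-refl (p∩q⊆p V₀ (∁ C)) (UV-disjoint i zero)

  W∷U⊆V₀∷U : ∀ i → lookup (W ∷ U) i ⊆ lookup (V₀ ∷ U) i
  W∷U⊆V₀∷U zero    = p∩q⊆p V₀ (∁ C)
  W∷U⊆V₀∷U (suc i) = ⊆-refl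

  W-apart-M′ : All (Disjoint W) M′
  W-apart-M′ = Disjoint-⋃⁻ M′ (Disjoint⁺ λ x∈W x∈C → x∈∁p⇒x∉p (p∩q⊆q V₀ (∁ C) x∈W) x∈C)

  M′-apart-M″ : ∀ {M″} → All (λ e → Crosses e (W ∷ U)) M″ → All (λ e′ → All (Disjoint e′) M″) M′
  M′-apart-M″ M″-crossing = All.zipWith
    (λ (e′-crosses , W-apart-e′) →
       All.map (crossings-apart {V = V} UV-disjoint e′-crosses W-apart-e′) M″-crossing)
    (M′-crossing , W-apart-M′)
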